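{- Let $L=(a_1,\ldots,a_N)$ be a list, $F$ its induced discrete distribution, and $b\in\mathbb{N}$ with $b\le N$. Let $\sigma$ be a uniformly random permutation of $\{1,\ldots,N\}$ and $\sigma(L)_{[1:b]}=(a_{\sigma(1)},\ldots,a_{\sigma(b)})$. Then for $A\in\{\mathrm{DNF},\mathrm{OPT}\}$, \[ \left|\mathbb{E}[A(\sigma(L)_{[1:b]})]-\mathbb{E}[A(I_b(F))]\right|\le\frac{b^3}{N}. \]
   Context: Bin covering: for a list of item sizes in $[0,1]$, a bin is covered if its total size is at least $1$; $\mathrm{OPT}$ of a list is the maximum number of pairwise disjoint sets of items each of total size at least $1$. Dual Next-Fit ($\mathrm{DNF}$) puts every item (in order) into a single current bin; as soon as the current bin has total size at least $1$ it is counted as covered and a new empty current bin is started; $\mathrm{DNF}$ of a list is the number of covered bins. The distribution $F$ induced by $L$ has as sizes the distinct values in $L$, value $v$ having probability $|\{j:a_j=v\}|/N$; $I_b(F)$ is a list of $b$ i.i.d. items drawn from $F$.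
   Formalization: The item sizes of the list L are rational numbers in [0,1]. -}

module Defs where

open import Data.Bool using (Bool; true; false; if_then_else_; _∧_)
open import Data.Nat as ℕ using (ℕ; zero; suc; NonZero)
open import Data.Integer using (+_)
open import Data.Fin using (Fin)
import Data.Fin.Properties as FinP
import Data.Nat.Properties as NP
import Data.Bool
open import Data.Maybe using (Maybe; just; nothing)
open import Data.List using (List; []; _∷_; map; concatMap; foldr; length; filter; deduplicate; allFin; upTo; take; zip)
open import Data.Product using (_×_; _,_; proj₁; proj₂)
open import Data.Rational using (ℚ; 0ℚ; 1ℚ; _+_; _*_; _/_; _≤?_; _≟_)
open import Relation.Nullary.Decidable using (⌊_⌋)
open import Data.Bool.ListAction using (all; any)

sumℚ : List ℚ → ℚ
sumℚ = foldr _+_ 0ℚ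

DNF-go : ℚ → List ℚ → ℕ
DNF-go s [] = 0
DNF-go s (a ∷ as) =
  if ⌊ 1ℚ ≤? (s + a) ⌋ then suc (DNF-go 0ℚ as) else DNF-go (s + a) as

DNF : List ℚ → ℕ
DNF = DNF-go 0ℚ

-- OPT: maximum number k of pairwise disjoint sets of items, each of
-- total size ≥ 1.  A choice of k pairwise disjoint sets of items is an
-- assignment of each item to one of the bins 0..k-1 or to no bin.

assignments : (k n : ℕ) → List (List (Maybe (Fin k)))
assignments k zero = [] ∷ []
assignments k (suc n) =
  concatMap (λ r → map (λ o → o ∷ r) (nothing ∷ map just (allFin k)))
            (assignments k n)

isBin : {k : ℕ} → Fin k → Maybe (Fin k) → Bool
isBin j nothing = false
isBin j (just i) = ⌊ i FinP.≟ j ⌋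

binSize : {k : ℕ} → Fin k → List ℚ → List (Maybe (Fin k)) → ℚ
binSize j xs as = sumℚ (map proj₁ (filter (λ p → isBin j (proj₂ p) Data.Bool.≟ true) (zip xs as)))

coverable : List ℚ → ℕ → Bool
coverable xs k =
  any (λ as → all (λ j → ⌊ 1ℚ ≤? binSize j xs as ⌋) (allFin k))
      (assignments k (length xs))

OPT : List ℚ → ℕ
OPT xs = foldr (λ k m → if coverable xs k then ℕ._⊔_ k m else m) 0
               (upTo (suc (length xs)))

-- Random permutation: list of all N! rearrangements σ(L) of L
-- (positions are distinguished, so equal values still give N! entries).

insertions : {A : Set} → A → List A → List (List A)
insertions x [] = (x ∷ []) ∷ []
insertions x (y ∷ ys) = (x ∷ y ∷ ys) ∷ map (y ∷_) (insertions x ys)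

permutations : {A : Set} → List A → List (List A)
permutations [] = [] ∷ []
permutations (x ∷ xs) = concatMap (insertions x) (permutations xs)

toℚ : ℕ → ℚ
toℚ n = (+ n) / 1

-- E[A(σ(L)_{[1:b]})] for uniform σ : average over all N! permutations
E-perm : (List ℚ → ℕ) → (L : List ℚ) → .{{NonZero (length L)}} → ℕ → ℚ
E-perm A L b =
  ((+ 1) / (length L ℕ.!)) {{NP._!≢0 (length L)}}
    * sumℚ (map (λ l → toℚ (A (take b l))) (permutations L))

-- Induced distribution F: support = distinct values of L,
-- P(v) = |{j : a_j = v}| / N.

count : ℚ → List ℚ → ℕ
count v L = length (filter (λ a → a ≟ v) L)

support : List ℚ → List ℚ
support = deduplicate _≟_

prob : (L : List ℚ) → .{{NonZero (length L)}} → ℚ → ℚ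
prob L v = (+ count v L) / length L

tuples : {A : Set} → List A → ℕ → List (List A)
tuples S zero = [] ∷ []
tuples S (suc b) = concatMap (λ t → map (_∷ t) S) (tuples S b)

productℚ : List ℚ → ℚ
productℚ = foldr _*_ 1ℚ

-- E[A(I_b(F))] where I_b(F) is b i.i.d. draws from F
E-iid : (List ℚ → ℕ) → (L : List ℚ) → .{{NonZero (length L)}} → ℕ → ℚ
E-iid A L b =
  sumℚ (map (λ t → productℚ (map (prob L) t) * toℚ (A t))
            (tuples (support L) b))

-- Let N = length L and let A be any statistic with A s ≤ length s, as DNF and OPT are.
-- Grouping permutations by their first b entries shows that the b-prefix of a uniform
-- permutation is a uniform arrangement (ordered choice of b distinct positions), so
-- E-perm = Q / K, where K = N P′ b is the number of arrangements and Q sums A over them.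
-- Grouping the N^b tuples of positions by the values they spell gives E-iid = I / N^b,
-- where I sums A over all position tuples. The arrangements are among these tuples and each
-- of the other N^b − K tuples contributes between 0 and b, so Q/K − I/N^b and I/N^b − Q/K
-- are both at most b (N^b − K) / N^b; finally N^b − K ≤ b² N^(b−1).

module Submission where

open import Defs
open import Data.Nat using (ℕ; _≤_; _^_; NonZero)
open import Data.Integer using (+_)
open import Data.List using (List; length)
open import Data.List.Relation.Unary.All using (All)
open import Data.Product using (_×_)
open import Data.Rational using (ℚ; 0ℚ; 1ℚ; _-_; ∣_∣; _/_)
import Data.Rational as Q

open import Data.Bool using (true; false; if_then_else_)
import Data.Integer as ℤ
import Data.Integer.Properties as ℤP
open import Data.List using ([]; _∷_; [_]; _++_; map; concatMap; foldr; take; upTo)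
open import Data.List.Membership.Propositional using (_∈_)
open import Data.List.Membership.Propositional.Properties using (∈-deduplicate⁺)
open import Data.List.Properties using (map-++; map-∘; map-cong; length-map)
open import Data.List.Relation.Binary.Permutation.Propositional
  using (_↭_; ↭-refl; ↭-prep; ↭-swap; ↭-trans)
open import Data.List.Relation.Binary.Permutation.Propositional.Properties
  using (↭-length) renaming (map⁺ to ↭-map⁺)
open import Data.List.Relation.Unary.All using ([]; _∷_)
import Data.List.Relation.Unary.All as All
import Data.List.Relation.Unary.All.Properties as AllP
open import Data.List.Relation.Unary.AllPairs using ([]; _∷_)
open import Data.List.Relation.Unary.Any using (here; there)
open import Data.List.Relation.Unary.Unique.Propositional using (Unique)
open import Data.List.Relation.Unary.Unique.DecPropositional.Properties Q._≟_ using (deduplicate-!)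
open import Data.Nat using (zero; suc; pred; _+_; _*_; _∸_; _!; _⊔_; z≤n; s≤s)
open import Data.Nat.Combinatorics.Base using (_P′_)
open import Data.Nat.ListAction using (sum; product)
open import Data.Nat.ListAction.Properties using (sum-↭; sum-++)
open import Data.Nat.Properties
open import Algebra.Properties.CommutativeSemigroup *-commutativeSemigroup using (x∙yz≈y∙xz)
open import Data.Nat.Tactic.RingSolver using (solve-∀)
open import Data.Product using (_,_; proj₁; proj₂; map₂)
import Data.Rational.Properties as QP
open import Data.Rational.Solver using (module +-*-Solver)
import Data.Rational.Unnormalised as ℚᵘ
import Data.Rational.Unnormalised.Properties as ℚᵘP
open import Data.Sum using ([_,_]′)
open import Function using (_∘_)
open import Relation.Binary.PropositionalEquality hiding ([_])
open import Relation.Nullary using (yes; no; contradiction)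
open import Relation.Nullary.Decidable using (⌊_⌋)

P′-suc : (n b : ℕ) → n P′ suc b ≡ n * ((n ∸ 1) P′ b)
P′-suc n zero = refl
P′-suc n (suc b) = begin
    (n ∸ suc b) * (n P′ suc b)
  ≡⟨ cong ((n ∸ suc b) *_) (P′-suc n b) ⟩
    (n ∸ suc b) * (n * ((n ∸ 1) P′ b))
  ≡⟨ x∙yz≈y∙xz (n ∸ suc b) n _ ⟩
    n * ((n ∸ suc b) * ((n ∸ 1) P′ b))
  ≡⟨ cong (λ m → n * (m * ((n ∸ 1) P′ b))) (sym (∸-+-assoc n 1 b)) ⟩
    n * ((n ∸ 1) P′ suc b)
  ∎
  where open ≡-Reasoning

P′≤^ : (n b : ℕ) → n P′ b ≤ n ^ b
P′≤^ n zero = ≤-refl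
P′≤^ n (suc b) = *-mono-≤ (m∸n≤m n b) (P′≤^ n b)

-- n^b − n P′ b ≤ b² n^(b−1), without subtraction or division.
^≤P′+ : (n b : ℕ) → b ≤ n → n * n ^ b ≤ n * (n P′ b) + b * b * n ^ b
^≤P′+ n zero _ = m≤m+n (n * 1) 0
^≤P′+ n (suc b) 1+b≤n = begin
    n * (n * M)
  ≡⟨ cong (_* (n * M)) (sym (m∸n+n≡m b≤n)) ⟩
    (e + b) * (n * M)
  ≡⟨ *-distribʳ-+ (n * M) e b ⟩
    e * (n * M) + b * (n * M)
  ≤⟨ +-monoˡ-≤ (b * (n * M)) (*-monoʳ-≤ e (^≤P′+ n b b≤n)) ⟩
    e * (n * F + b * b * M) + b * (n * M)
  ≡⟨ expand e n F b M ⟩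
    n * (e * F) + (b * b * M * e + b * (n * M))
  ≤⟨ +-monoʳ-≤ (n * (e * F)) (+-monoˡ-≤ (b * (n * M)) (*-monoʳ-≤ (b * b * M) (m∸n≤m n b))) ⟩
    n * (e * F) + (b * b * M * n + b * (n * M))
  ≡⟨ cong (_+_ (n * (e * F))) (collect b M n) ⟩
    n * (e * F) + (b * b + b) * (n * M)
  ≤⟨ +-monoʳ-≤ (n * (e * F)) (*-monoˡ-≤ (n * M) b²+b≤[1+b]²) ⟩
    n * (e * F) + suc b * suc b * (n * M)
  ∎
  where
  open ≤-Reasoning
  b≤n = ≤-trans (n≤1+n b) 1+b≤n
  e = n ∸ b
  F = n P′ b
  M = n ^ b
  expand : ∀ e n F b M → e * (n * F + b * b * M) + b * (n * M) ≡ n * (e * F) + (b * b * M * e + b * (n * M))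
  expand = solve-∀
  collect : ∀ b M n → b * b * M * n + b * (n * M) ≡ (b * b + b) * (n * M)
  collect = solve-∀
  b²+b≤[1+b]² : b * b + b ≤ suc b * suc b
  b²+b≤[1+b]² = ≤-trans (m≤m+n (b * b + b) (suc b)) (≤-reflexive (square-suc b))
    where
    square-suc : ∀ b → (b * b + b) + suc b ≡ suc b * suc b
    square-suc = solve-∀

+-diff-trans : ∀ {a g z k u M} → a + u ≤ g + M → g + k ≤ z + u → a + k ≤ z + M
+-diff-trans {a} {g} {z} {k} {u} {M} a+u≤g+M g+k≤z+u = +-cancelˡ-≤ (g + u) (a + k) (z + M)
  (subst₂ _≤_ (shuffle₁ a u g k) (shuffle₂ g M z u) (+-mono-≤ a+u≤g+M g+k≤z+u))
  where
  shuffle₁ : ∀ a u g k → (a + u) + (g + k) ≡ (g + u) + (a + k)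
  shuffle₁ = solve-∀
  shuffle₂ : ∀ g M z u → (g + M) + (z + u) ≡ (g + u) + (z + M)
  shuffle₂ = solve-∀

-- With E-perm = Q/K, E-iid = I/M and M = N^b, these say ∣Q/K − I/M∣ ≤ b³/N with denominators cleared.
module _ {Q I K M N b : ℕ} (Q≤I : Q ≤ I) (Q≤Kb : Q ≤ K * b) (I+Kb≤Q+Mb : I + K * b ≤ Q + M * b)
         (K≤M : K ≤ M) (NM≤NK+b²M : N * M ≤ N * K + b * b * M) where

  cross-bound-≤ : Q * (M * N) ≤ I * (K * N) + b ^ 3 * (K * M)
  cross-bound-≤ = begin
      Q * (M * N)
    ≡⟨ cong (Q *_) (*-comm M N) ⟩
      Q * (N * M)
    ≤⟨ *-monoʳ-≤ Q NM≤NK+b²M ⟩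
      Q * (N * K + b * b * M)
    ≡⟨ *-distribˡ-+ Q (N * K) (b * b * M) ⟩
      Q * (N * K) + Q * (b * b * M)
    ≤⟨ +-mono-≤ (*-monoˡ-≤ (N * K) Q≤I) (*-monoˡ-≤ (b * b * M) Q≤Kb) ⟩
      I * (N * K) + K * b * (b * b * M)
    ≡⟨ rearrange I N K b M ⟩
      I * (K * N) + b ^ 3 * (K * M)
    ∎
    where
    open ≤-Reasoning
    -- b ^ 3 unfolds to b * (b * (b * 1)), the form the ring solver accepts.
    rearrange : ∀ I N K b M → I * (N * K) + K * b * (b * b * M) ≡ I * (K * N) + b * (b * (b * 1)) * (K * M)
    rearrange = solve-∀

  cross-bound-≥ : I * (K * N) ≤ Q * (M * N) + b ^ 3 * (K * M)
  cross-bound-≥ = ≤-trans (+-cancelˡ-≤ X _ _ shifted)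
                          (+-monoˡ-≤ (b ^ 3 * (K * M)) (*-monoʳ-≤ Q (*-monoˡ-≤ N K≤M)))
    where
    open ≤-Reasoning
    X = K * b * (K * N)
    shifted : X + I * (K * N) ≤ X + (Q * (K * N) + b ^ 3 * (K * M))
    shifted = begin
        X + I * (K * N)
      ≡⟨ factor K b N I ⟩
        (I + K * b) * (K * N)
      ≤⟨ *-monoˡ-≤ (K * N) I+Kb≤Q+Mb ⟩
        (Q + M * b) * (K * N)
      ≡⟨ expand Q M b K N ⟩
        Q * (K * N) + K * b * (N * M)
      ≤⟨ +-monoʳ-≤ (Q * (K * N)) (*-monoʳ-≤ (K * b) NM≤NK+b²M) ⟩
        Q * (K * N) + K * b * (N * K + b * b * M)
      ≡⟨ regroup Q K N b M ⟩
        X + (Q * (K * N) + b ^ 3 * (K * M))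
      ∎
      where
      factor : ∀ K b N I → K * b * (K * N) + I * (K * N) ≡ (I + K * b) * (K * N)
      factor = solve-∀
      expand : ∀ Q M b K N → (Q + M * b) * (K * N) ≡ Q * (K * N) + K * b * (N * M)
      expand = solve-∀
      regroup : ∀ Q K N b M → Q * (K * N) + K * b * (N * K + b * b * M)
                              ≡ K * b * (K * N) + (Q * (K * N) + b * (b * (b * 1)) * (K * M))
      regroup = solve-∀

∑ : {A : Set} → (A → ℕ) → List A → ℕ
∑ f xs = sum (map f xs)

syntax ∑ (λ x → e) xs = ∑[ x ← xs ] e

module _ {A : Set} where

  ∑-++ : (f : A → ℕ) (xs ys : List A) → ∑ f (xs ++ ys) ≡ ∑ f xs + ∑ f ys
  ∑-++ f xs ys = trans (cong sum (map-++ f xs ys)) (sum-++ (map f xs) (map f ys))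

  ∑-↭ : (f : A → ℕ) {xs ys : List A} → xs ↭ ys → ∑ f xs ≡ ∑ f ys
  ∑-↭ f p = sum-↭ (↭-map⁺ f p)

  ∑-cong : {f g : A → ℕ} → (∀ x → f x ≡ g x) → (xs : List A) → ∑ f xs ≡ ∑ g xs
  ∑-cong f≗g xs = cong sum (map-cong f≗g xs)

  ∑-cong-All : {f g : A → ℕ} {xs : List A} → All (λ x → f x ≡ g x) xs → ∑ f xs ≡ ∑ g xs
  ∑-cong-All [] = refl
  ∑-cong-All (e ∷ es) = cong₂ _+_ e (∑-cong-All es)

  ∑-mono-All : {f g : A → ℕ} {xs : List A} → All (λ x → f x ≤ g x) xs → ∑ f xs ≤ ∑ g xs
  ∑-mono-All [] = ≤-refl
  ∑-mono-All (le ∷ les) = +-mono-≤ le (∑-mono-All les)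

  ∑-mono : {f g : A → ℕ} → (∀ x → f x ≤ g x) → (xs : List A) → ∑ f xs ≤ ∑ g xs
  ∑-mono f≤g xs = ∑-mono-All {xs = xs} (All.tabulate (λ {x} _ → f≤g x))

  ∑-+ : (f g : A → ℕ) (xs : List A) → ∑[ x ← xs ] (f x + g x) ≡ ∑ f xs + ∑ g xs
  ∑-+ f g [] = refl
  ∑-+ f g (x ∷ xs) = trans (cong (_+_ (f x + g x)) (∑-+ f g xs)) (shuffle (f x) (g x) _ _)
    where
    shuffle : ∀ a b c d → a + b + (c + d) ≡ a + c + (b + d)
    shuffle = solve-∀

  ∑-*ˡ : (c : ℕ) (f : A → ℕ) (xs : List A) → ∑[ x ← xs ] (c * f x) ≡ c * ∑ f xs
  ∑-*ˡ c f [] = sym (*-zeroʳ c)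
  ∑-*ˡ c f (x ∷ xs) = trans (cong (_+_ (c * f x)) (∑-*ˡ c f xs)) (sym (*-distribˡ-+ c (f x) _))

  ∑-const : (c : ℕ) (xs : List A) → ∑[ _ ← xs ] c ≡ length xs * c
  ∑-const c [] = refl
  ∑-const c (x ∷ xs) = cong (_+_ c) (∑-const c xs)

  ∑-zeros : {f : A → ℕ} {xs : List A} → All (λ x → f x ≡ 0) xs → ∑ f xs ≡ 0
  ∑-zeros {xs = xs} f≡0 = trans (∑-cong-All f≡0) (trans (∑-const 0 xs) (*-zeroʳ (length xs)))

  ∑-1 : (xs : List A) → ∑[ _ ← xs ] 1 ≡ length xs
  ∑-1 xs = trans (∑-const 1 xs) (*-identityʳ (length xs))

  ∑-*ʳ : (f : A → ℕ) (c : ℕ) (xs : List A) → ∑[ x ← xs ] (f x * c) ≡ ∑ f xs * c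
  ∑-*ʳ f c xs = trans (∑-cong (λ x → *-comm (f x) c) xs) (trans (∑-*ˡ c f xs) (*-comm c (∑ f xs)))

  ∑-≤-length-* : {f : A → ℕ} {c : ℕ} {xs : List A} → All (λ x → f x ≤ c) xs → ∑ f xs ≤ length xs * c
  ∑-≤-length-* {c = c} {xs} f≤c = ≤-trans (∑-mono-All f≤c) (≤-reflexive (∑-const c xs))

module _ {A B : Set} where

  ∑-map : (f : B → ℕ) (g : A → B) (xs : List A) → ∑ f (map g xs) ≡ ∑ (f ∘ g) xs
  ∑-map f g xs = cong sum (sym (map-∘ xs))

  ∑-concatMap : (f : B → ℕ) (g : A → List B) (xs : List A) →
                ∑ f (concatMap g xs) ≡ ∑[ x ← xs ] ∑ f (g x)
  ∑-concatMap f g [] = refl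
  ∑-concatMap f g (x ∷ xs) = trans (∑-++ f (g x) (concatMap g xs)) (cong (_+_ (∑ f (g x))) (∑-concatMap f g xs))

  ∑-swap : (f : A → B → ℕ) (xs : List A) (ys : List B) →
           ∑[ x ← xs ] ∑ (f x) ys ≡ ∑[ y ← ys ] ∑[ x ← xs ] f x y
  ∑-swap f [] ys = sym (trans (∑-const 0 ys) (*-zeroʳ (length ys)))
  ∑-swap f (x ∷ xs) ys =
    trans (cong (_+_ (∑ (f x) ys)) (∑-swap f xs ys)) (sym (∑-+ (f x) (λ y → ∑[ x ← xs ] f x y) ys))

select : {A : Set} → List A → List (A × List A)
select [] = []
select (x ∷ xs) = (x , xs) ∷ map (map₂ (x ∷_)) (select xs)

-- Ordered selections of b distinct positions of L: the possible prefixes σ(L)[1:b].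
arrangements : {A : Set} → List A → ℕ → List (List A)
arrangements L zero = [] ∷ []
arrangements L (suc b) =
  concatMap (λ p → map (proj₁ p ∷_) (arrangements (proj₂ p) b)) (select L)

module _ {A : Set} where

  select-↭ : (L : List A) → All (λ p → L ↭ proj₁ p ∷ proj₂ p) (select L)
  select-↭ [] = []
  select-↭ (x ∷ xs) = ↭-refl ∷ AllP.map⁺ (All.map swap-head (select-↭ xs))
    where
    swap-head : ∀ {p} → xs ↭ proj₁ p ∷ proj₂ p → x ∷ xs ↭ proj₁ p ∷ x ∷ proj₂ p
    swap-head {p} xs↭ = ↭-trans (↭-prep x xs↭) (↭-swap x (proj₁ p) ↭-refl)

  ∑-select-proj₁ : (f : A → ℕ) (L : List A) → ∑[ p ← select L ] f (proj₁ p) ≡ ∑ f L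
  ∑-select-proj₁ f [] = refl
  ∑-select-proj₁ f (x ∷ xs) =
    cong (_+_ (f x)) (trans (∑-map (f ∘ proj₁) (map₂ (x ∷_)) (select xs)) (∑-select-proj₁ f xs))

  length-select : (L : List A) → length (select L) ≡ length L
  length-select [] = refl
  length-select (x ∷ xs) = cong suc (trans (length-map (map₂ (x ∷_)) (select xs)) (length-select xs))

  ∑-insertions : (f : List A → ℕ) (y x : A) (τ : List A) →
    ∑ f (insertions y (x ∷ τ)) ≡ f (y ∷ x ∷ τ) + ∑ (f ∘ (x ∷_)) (insertions y τ)
  ∑-insertions f y x τ = cong (_+_ (f (y ∷ x ∷ τ))) (∑-map f (x ∷_) (insertions y τ))

  ∑-permutations-∷ : (f : List A → ℕ) (y : A) (ys : List A) →
    ∑ f (permutations (y ∷ ys)) ≡ ∑[ p ← select (y ∷ ys) ] ∑[ τ ← permutations (proj₂ p) ] f (proj₁ p ∷ τ)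
  ∑-permutations-∷ f y [] = sym (+-identityʳ _)
  ∑-permutations-∷ f y (z ∷ zs) = begin
      ∑ f (concatMap (insertions y) (permutations (z ∷ zs)))
    ≡⟨ ∑-concatMap f (insertions y) (permutations (z ∷ zs)) ⟩
      ∑ (∑ f ∘ insertions y) (permutations (z ∷ zs))
    ≡⟨ ∑-permutations-∷ (∑ f ∘ insertions y) z zs ⟩
      ∑[ p ← S ] ∑[ τ ← permutations (proj₂ p) ] ∑ f (insertions y (proj₁ p ∷ τ))
    ≡⟨ ∑-cong split S ⟩
      ∑[ p ← S ] (y-first p + x-first p)
    ≡⟨ ∑-+ y-first x-first S ⟩
      ∑ y-first S + ∑ x-first S
    ≡⟨ cong₂ _+_ (sym (∑-permutations-∷ (f ∘ (y ∷_)) z zs)) (sym (∑-map _ (map₂ (y ∷_)) S)) ⟩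
      ∑[ p ← select (y ∷ z ∷ zs) ] ∑[ τ ← permutations (proj₂ p) ] f (proj₁ p ∷ τ)
    ∎
    where
    open ≡-Reasoning
    S = select (z ∷ zs)
    y-first x-first : A × List A → ℕ
    y-first p = ∑[ τ ← permutations (proj₂ p) ] f (y ∷ proj₁ p ∷ τ)
    x-first p = ∑ (f ∘ (proj₁ p ∷_)) (permutations (y ∷ proj₂ p))
    split : (p : A × List A) →
      ∑[ τ ← permutations (proj₂ p) ] ∑ f (insertions y (proj₁ p ∷ τ)) ≡ y-first p + x-first p
    split (x , r) = begin
        ∑[ τ ← permutations r ] ∑ f (insertions y (x ∷ τ))
      ≡⟨ ∑-cong (∑-insertions f y x) (permutations r) ⟩
        ∑[ τ ← permutations r ] (f (y ∷ x ∷ τ) + ∑ (f ∘ (x ∷_)) (insertions y τ))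
      ≡⟨ ∑-+ (λ τ → f (y ∷ x ∷ τ)) (∑ (f ∘ (x ∷_)) ∘ insertions y) (permutations r) ⟩
        y-first (x , r) + ∑[ τ ← permutations r ] ∑ (f ∘ (x ∷_)) (insertions y τ)
      ≡⟨ cong (_+_ (y-first (x , r))) (sym (∑-concatMap (f ∘ (x ∷_)) (insertions y) (permutations r))) ⟩
        y-first (x , r) + x-first (x , r)
      ∎

  length-permutations : (n : ℕ) (L : List A) → length L ≡ n → length (permutations L) ≡ n !
  length-permutations zero [] _ = refl
  length-permutations (suc n) (y ∷ ys) |L|≡1+n = begin
      length (permutations (y ∷ ys))
    ≡⟨ sym (∑-1 (permutations (y ∷ ys))) ⟩
      ∑[ _ ← permutations (y ∷ ys) ] 1
    ≡⟨ ∑-permutations-∷ (λ _ → 1) y ys ⟩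
      ∑[ p ← select (y ∷ ys) ] ∑[ _ ← permutations (proj₂ p) ] 1
    ≡⟨ ∑-cong-All (All.map (λ {p} L↭ → trans (∑-1 (permutations (proj₂ p)))
                                              (length-permutations n (proj₂ p) (length-rest L↭)))
                           (select-↭ (y ∷ ys))) ⟩
      ∑[ _ ← select (y ∷ ys) ] (n !)
    ≡⟨ ∑-const (n !) (select (y ∷ ys)) ⟩
      length (select (y ∷ ys)) * n !
    ≡⟨ cong (_* n !) (trans (length-select (y ∷ ys)) |L|≡1+n) ⟩
      suc n !
    ∎
    where
    open ≡-Reasoning
    length-rest : ∀ {x r} → y ∷ ys ↭ x ∷ r → length r ≡ n
    length-rest L↭ = suc-injective (trans (sym (↭-length L↭)) |L|≡1+n)

  ∑-arrangements-suc : (h : List A → ℕ) (L : List A) (b : ℕ) →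
    ∑ h (arrangements L (suc b)) ≡ ∑[ p ← select L ] ∑[ s ← arrangements (proj₂ p) b ] h (proj₁ p ∷ s)
  ∑-arrangements-suc h L b =
    trans (∑-concatMap h _ (select L)) (∑-cong (λ p → ∑-map h (proj₁ p ∷_) (arrangements (proj₂ p) b)) (select L))

  length-arrangements-suc : (L : List A) (b : ℕ) →
    length (arrangements L (suc b)) ≡ ∑[ p ← select L ] length (arrangements (proj₂ p) b)
  length-arrangements-suc L b = trans (sym (∑-1 (arrangements L (suc b))))
    (trans (∑-arrangements-suc (λ _ → 1) L b) (∑-cong (λ p → ∑-1 (arrangements (proj₂ p) b)) (select L)))

  ∑-permutations-take : (b : ℕ) (L : List A) → b ≤ length L → (h : List A → ℕ) →
    ∑[ σ ← permutations L ] h (take b σ) ≡ (length L ∸ b) ! * ∑ h (arrangements L b)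
  ∑-permutations-take zero L _ h = begin
      ∑[ _ ← permutations L ] h []
    ≡⟨ ∑-const (h []) (permutations L) ⟩
      length (permutations L) * h []
    ≡⟨ cong₂ _*_ (length-permutations (length L) L refl) (sym (+-identityʳ (h []))) ⟩
      length L ! * ∑ h (arrangements L zero)
    ∎
    where open ≡-Reasoning
  ∑-permutations-take (suc b) (y ∷ ys) (s≤s b≤|ys|) h = begin
      ∑[ σ ← permutations (y ∷ ys) ] h (take (suc b) σ)
    ≡⟨ ∑-permutations-∷ (h ∘ take (suc b)) y ys ⟩
      ∑[ p ← S ] ∑[ τ ← permutations (proj₂ p) ] h (proj₁ p ∷ take b τ)
    ≡⟨ ∑-cong-All (All.map (λ {p} L↭ → on-rest p (↭-length L↭)) (select-↭ (y ∷ ys))) ⟩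
      ∑[ p ← S ] ((length ys ∸ b) ! * ∑[ s ← arrangements (proj₂ p) b ] h (proj₁ p ∷ s))
    ≡⟨ ∑-*ˡ ((length ys ∸ b) !) _ S ⟩
      (length ys ∸ b) ! * ∑[ p ← S ] ∑[ s ← arrangements (proj₂ p) b ] h (proj₁ p ∷ s)
    ≡⟨ cong (_*_ ((length ys ∸ b) !)) (sym (∑-arrangements-suc h (y ∷ ys) b)) ⟩
      (length ys ∸ b) ! * ∑ h (arrangements (y ∷ ys) (suc b))
    ∎
    where
    open ≡-Reasoning
    S = select (y ∷ ys)
    on-rest : (p : A × List A) → suc (length ys) ≡ suc (length (proj₂ p)) →
      ∑[ τ ← permutations (proj₂ p) ] h (proj₁ p ∷ take b τ)
        ≡ (length ys ∸ b) ! * ∑[ s ← arrangements (proj₂ p) b ] h (proj₁ p ∷ s)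
    on-rest (x , r) |L|≡|x∷r| =
      trans (∑-permutations-take b r (subst (b ≤_) |ys|≡|r| b≤|ys|) (h ∘ (x ∷_)))
            (cong (λ n → (n ∸ b) ! * ∑[ s ← arrangements r b ] h (x ∷ s)) (sym |ys|≡|r|))
      where
      |ys|≡|r| = suc-injective |L|≡|x∷r|

  length-arrangements : (L : List A) (b : ℕ) → length (arrangements L b) ≡ length L P′ b
  length-arrangements L zero = refl
  length-arrangements L (suc b) = begin
      length (arrangements L (suc b))
    ≡⟨ length-arrangements-suc L b ⟩
      ∑[ p ← select L ] length (arrangements (proj₂ p) b)
    ≡⟨ ∑-cong-All (All.map (λ {p} L↭ → on-rest p (↭-length L↭)) (select-↭ L)) ⟩
      ∑[ _ ← select L ] ((length L ∸ 1) P′ b)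
    ≡⟨ ∑-const ((length L ∸ 1) P′ b) (select L) ⟩
      length (select L) * ((length L ∸ 1) P′ b)
    ≡⟨ cong (_* ((length L ∸ 1) P′ b)) (length-select L) ⟩
      length L * ((length L ∸ 1) P′ b)
    ≡⟨ sym (P′-suc (length L) b) ⟩
      length L P′ suc b
    ∎
    where
    open ≡-Reasoning
    on-rest : (p : A × List A) → length L ≡ suc (length (proj₂ p)) →
      length (arrangements (proj₂ p) b) ≡ (length L ∸ 1) P′ b
    on-rest (x , r) |L|≡1+|r| =
      trans (length-arrangements r b) (cong (λ n → pred n P′ b) (sym |L|≡1+|r|))

Bounded : {A : Set} → ℕ → ℕ → (List A → ℕ) → Set
Bounded b B h = ∀ s → length s ≡ b → h s ≤ B

module _ {A : Set} where

  Bounded-∷ : ∀ {b B} {h : List A → ℕ} (x : A) → Bounded (suc b) B h → Bounded b B (h ∘ (x ∷_))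
  Bounded-∷ x bounded s |s|≡b = bounded (x ∷ s) (cong suc |s|≡b)

  ∑-≤-Bounded : ∀ {b B} {h : List A → ℕ} {xs : List (List A)} →
    All (λ s → length s ≡ b) xs → Bounded b B h → ∑ h xs ≤ length xs * B
  ∑-≤-Bounded lengths bounded = ∑-≤-length-* (All.map (bounded _) lengths)

  ∑-tuples-suc : (h : List A → ℕ) (L : List A) (b : ℕ) →
    ∑ h (tuples L (suc b)) ≡ ∑[ t ← tuples L b ] ∑[ a ← L ] h (a ∷ t)
  ∑-tuples-suc h L b =
    trans (∑-concatMap h _ (tuples L b)) (∑-cong (λ t → ∑-map h (_∷ t) L) (tuples L b))

  ∑-tuples-suc′ : (h : List A → ℕ) (L : List A) (b : ℕ) →
    ∑ h (tuples L (suc b)) ≡ ∑[ a ← L ] ∑[ t ← tuples L b ] h (a ∷ t)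
  ∑-tuples-suc′ h L b = trans (∑-tuples-suc h L b) (∑-swap (λ t a → h (a ∷ t)) (tuples L b) L)

  length-tuples : (L : List A) (b : ℕ) → length (tuples L b) ≡ length L ^ b
  length-tuples L zero = refl
  length-tuples L (suc b) = begin
      length (tuples L (suc b))
    ≡⟨ sym (∑-1 (tuples L (suc b))) ⟩
      ∑[ _ ← tuples L (suc b) ] 1
    ≡⟨ ∑-tuples-suc (λ _ → 1) L b ⟩
      ∑[ _ ← tuples L b ] ∑[ _ ← L ] 1
    ≡⟨ ∑-const (∑[ _ ← L ] 1) (tuples L b) ⟩
      length (tuples L b) * ∑[ _ ← L ] 1
    ≡⟨ cong₂ _*_ (length-tuples L b) (∑-1 L) ⟩
      length L ^ b * length L
    ≡⟨ *-comm (length L ^ b) (length L) ⟩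
      length L ^ suc b
    ∎
    where open ≡-Reasoning

  tuples-have-length : (L : List A) (b : ℕ) → All (λ t → length t ≡ b) (tuples L b)
  tuples-have-length L zero = refl ∷ []
  tuples-have-length L (suc b) =
    AllP.concat⁺ (AllP.map⁺ (All.map (λ |t|≡b → AllP.map⁺ (All.tabulate (λ _ → cong suc |t|≡b)))
                                     (tuples-have-length L b)))

  arrangements-have-length : (L : List A) (b : ℕ) → All (λ s → length s ≡ b) (arrangements L b)
  arrangements-have-length L zero = refl ∷ []
  arrangements-have-length L (suc b) =
    AllP.concat⁺ (AllP.map⁺ {xs = select L} {f = λ p → map (proj₁ p ∷_) (arrangements (proj₂ p) b)}
      (All.tabulate (λ {p} _ → AllP.map⁺ (All.map (cong suc) (arrangements-have-length (proj₂ p) b)))))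

  module _ {x : A} {r L : List A} (L↭x∷r : L ↭ x ∷ r) where

    ∑-tuples-remove-≤ : (b : ℕ) (h : List A → ℕ) → ∑ h (tuples r b) ≤ ∑ h (tuples L b)
    ∑-tuples-remove-≤ zero h = ≤-refl
    ∑-tuples-remove-≤ (suc b) h = begin
        ∑ h (tuples r (suc b))
      ≡⟨ ∑-tuples-suc′ h r b ⟩
        ∑ (G r) r
      ≤⟨ ∑-mono (λ a → ∑-tuples-remove-≤ b (h ∘ (a ∷_))) r ⟩
        ∑ (G L) r
      ≤⟨ m≤n+m (∑ (G L) r) (G L x) ⟩
        G L x + ∑ (G L) r
      ≡⟨ sym (∑-↭ (G L) L↭x∷r) ⟩
        ∑ (G L) L
      ≡⟨ sym (∑-tuples-suc′ h L b) ⟩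
        ∑ h (tuples L (suc b))
      ∎
      where
      open ≤-Reasoning
      G : List A → A → ℕ
      G K a = ∑[ t ← tuples K b ] h (a ∷ t)

    -- Each of the |L|^b − |r|^b tuples that use the position of x contributes at most B.
    ∑-tuples-≤-remove+ : (b B : ℕ) (h : List A → ℕ) → Bounded b B h →
      ∑ h (tuples L b) + length r ^ b * B ≤ ∑ h (tuples r b) + length L ^ b * B
    ∑-tuples-≤-remove+ zero B h _ = ≤-refl
    ∑-tuples-≤-remove+ (suc b) B h bounded = begin
        ∑ h (tuples L (suc b)) + n * n ^ b * B
      ≡⟨ cong₂ _+_ (trans (∑-tuples-suc′ h L b) (∑-↭ (G L) L↭x∷r))
                   (trans (*-assoc n (n ^ b) B) (sym (∑-const (n ^ b * B) r))) ⟩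
        G L x + ∑ (G L) r + ∑[ _ ← r ] (n ^ b * B)
      ≡⟨ trans (+-assoc (G L x) _ _) (cong (_+_ (G L x)) (sym (∑-+ (G L) (λ _ → n ^ b * B) r))) ⟩
        G L x + ∑[ a ← r ] (G L a + n ^ b * B)
      ≤⟨ +-mono-≤ (tuples-bound x)
                  (∑-mono (λ a → ∑-tuples-≤-remove+ b B (h ∘ (a ∷_)) (Bounded-∷ a bounded)) r) ⟩
        N ^ b * B + ∑[ a ← r ] (G r a + N ^ b * B)
      ≡⟨ cong (_+_ (N ^ b * B)) (trans (∑-+ (G r) (λ _ → N ^ b * B) r)
                                       (cong (_+_ (∑ (G r) r)) (∑-const (N ^ b * B) r))) ⟩
        N ^ b * B + (∑ (G r) r + n * (N ^ b * B))
      ≡⟨ trans (shuffle (N ^ b * B) (∑ (G r) r) n) (cong (λ m → ∑ (G r) r + m * (N ^ b * B)) (sym |L|≡1+n)) ⟩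
        ∑ (G r) r + length L * (N ^ b * B)
      ≡⟨ cong₂ _+_ (sym (∑-tuples-suc′ h r b)) (sym (*-assoc N (N ^ b) B)) ⟩
        ∑ h (tuples r (suc b)) + N ^ suc b * B
      ∎
      where
      open ≤-Reasoning
      n N : ℕ
      n = length r
      N = length L
      |L|≡1+n : N ≡ suc n
      |L|≡1+n = ↭-length L↭x∷r
      G : List A → A → ℕ
      G K a = ∑[ t ← tuples K b ] h (a ∷ t)
      tuples-bound : (a : A) → G L a ≤ N ^ b * B
      tuples-bound a = subst (λ m → G L a ≤ m * B) (length-tuples L b)
        (∑-≤-Bounded (tuples-have-length L b) (Bounded-∷ a bounded))
      shuffle : ∀ c s n → c + (s + n * c) ≡ s + suc n * c
      shuffle = solve-∀

  length-!-arrangements : (L : List A) (b : ℕ) → b ≤ length L →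
    length L ! ≡ (length L ∸ b) ! * length (arrangements L b)
  length-!-arrangements L b b≤|L| = begin
      length L !
    ≡⟨ sym (length-permutations (length L) L refl) ⟩
      length (permutations L)
    ≡⟨ sym (∑-1 (permutations L)) ⟩
      ∑[ _ ← permutations L ] 1
    ≡⟨ ∑-permutations-take b L b≤|L| (λ _ → 1) ⟩
      (length L ∸ b) ! * ∑[ _ ← arrangements L b ] 1
    ≡⟨ cong ((length L ∸ b) ! *_) (∑-1 (arrangements L b)) ⟩
      (length L ∸ b) ! * length (arrangements L b)
    ∎
    where open ≡-Reasoning

  ∑-arrangements-≤-tuples : (b : ℕ) (L : List A) (h : List A → ℕ) → ∑ h (arrangements L b) ≤ ∑ h (tuples L b)
  ∑-arrangements-≤-tuples zero L h = ≤-refl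
  ∑-arrangements-≤-tuples (suc b) L h = begin
      ∑ h (arrangements L (suc b))
    ≡⟨ ∑-arrangements-suc h L b ⟩
      ∑[ p ← select L ] ∑[ s ← arrangements (proj₂ p) b ] h (proj₁ p ∷ s)
    ≤⟨ ∑-mono (λ p → ∑-arrangements-≤-tuples b (proj₂ p) (h ∘ (proj₁ p ∷_))) (select L) ⟩
      ∑[ p ← select L ] ∑[ t ← tuples (proj₂ p) b ] h (proj₁ p ∷ t)
    ≤⟨ ∑-mono-All (All.map (λ {p} L↭ → ∑-tuples-remove-≤ L↭ b (h ∘ (proj₁ p ∷_))) (select-↭ L)) ⟩
      ∑[ p ← select L ] ∑[ t ← tuples L b ] h (proj₁ p ∷ t)
    ≡⟨ ∑-select-proj₁ (λ a → ∑[ t ← tuples L b ] h (a ∷ t)) L ⟩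
      ∑[ a ← L ] ∑[ t ← tuples L b ] h (a ∷ t)
    ≡⟨ sym (∑-tuples-suc′ h L b) ⟩
      ∑ h (tuples L (suc b))
    ∎
    where open ≤-Reasoning

  -- Each of the N^b − K tuples that repeat a position contributes at most B.
  ∑-tuples-≤-arrangements+ : (b B : ℕ) (L : List A) (h : List A → ℕ) → Bounded b B h →
    ∑ h (tuples L b) + length (arrangements L b) * B ≤ ∑ h (arrangements L b) + length L ^ b * B
  ∑-tuples-≤-arrangements+ zero B L h _ = ≤-refl
  ∑-tuples-≤-arrangements+ (suc b) B L h bounded = begin
      ∑ h (tuples L (suc b)) + length (arrangements L (suc b)) * B
    ≡⟨ cong₂ _+_ (trans (∑-tuples-suc′ h L b) (sym (∑-select-proj₁ (G L) L)))
                 (trans (cong (_* B) (length-arrangements-suc L b)) (sym (∑-*ʳ (K ∘ proj₂) B S))) ⟩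
      ∑[ p ← S ] G L (proj₁ p) + ∑[ p ← S ] (K (proj₂ p) * B)
    ≡⟨ sym (∑-+ (G L ∘ proj₁) (λ p → K (proj₂ p) * B) S) ⟩
      ∑[ p ← S ] (G L (proj₁ p) + K (proj₂ p) * B)
    ≤⟨ ∑-mono-All (All.map (λ {p} → per-choice p) (select-↭ L)) ⟩
      ∑[ p ← S ] (H p + length L ^ b * B)
    ≡⟨ trans (∑-+ H (λ _ → length L ^ b * B) S)
             (cong (_+_ (∑ H S)) (∑-const (length L ^ b * B) S)) ⟩
      ∑ H S + length S * (length L ^ b * B)
    ≡⟨ cong₂ _+_ (sym (∑-arrangements-suc h L b))
                 (trans (cong (_* (length L ^ b * B)) (length-select L)) (sym (*-assoc (length L) _ B))) ⟩
      ∑ h (arrangements L (suc b)) + length L ^ suc b * B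
    ∎
    where
    open ≤-Reasoning
    S = select L
    K : List A → ℕ
    K r = length (arrangements r b)
    G : List A → A → ℕ
    G M a = ∑[ t ← tuples M b ] h (a ∷ t)
    H : A × List A → ℕ
    H p = ∑[ s ← arrangements (proj₂ p) b ] h (proj₁ p ∷ s)
    per-choice : (p : A × List A) → L ↭ proj₁ p ∷ proj₂ p →
      G L (proj₁ p) + K (proj₂ p) * B ≤ H p + length L ^ b * B
    per-choice (x , r) L↭x∷r = +-diff-trans {g = G r x} {u = length r ^ b * B}
      (∑-tuples-≤-remove+ L↭x∷r b B (h ∘ (x ∷_)) (Bounded-∷ x bounded))
      (∑-tuples-≤-arrangements+ b B r (h ∘ (x ∷_)) (Bounded-∷ x bounded))

count-∷ : (v a : ℚ) (L : List ℚ) → count v (a ∷ L) ≡ count v [ a ] + count v L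
count-∷ v a L with a Q.≟ v
... | yes _ = refl
... | no _ = refl

count-[-]-self : (a : ℚ) → count a [ a ] ≡ 1
count-[-]-self a with a Q.≟ a
... | yes _ = refl
... | no a≢a = contradiction refl a≢a

count-[-]-≢ : {a v : ℚ} → a ≢ v → count v [ a ] ≡ 0
count-[-]-≢ {a} {v} a≢v with a Q.≟ v
... | yes a≡v = contradiction a≡v a≢v
... | no _ = refl

module _ (h : ℚ → ℕ) where

  ∑-count-[-] : {D : List ℚ} {a : ℚ} → Unique D → a ∈ D → ∑[ v ← D ] (count v [ a ] * h v) ≡ h a
  ∑-count-[-] {a = a} (a∉ ∷ _) (here refl) =
    trans (cong₂ _+_ (trans (cong (_* h a) (count-[-]-self a)) (*-identityˡ (h a)))
                     (∑-zeros (All.map (λ {v} a≢v → cong (_* h v) (count-[-]-≢ a≢v)) a∉)))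
          (+-identityʳ (h a))
  ∑-count-[-] {d ∷ _} (d∉ ∷ unique) (there a∈) =
    cong₂ _+_ (cong (_* h d) (count-[-]-≢ (≢-sym (All.lookup d∉ a∈)))) (∑-count-[-] unique a∈)

  ∑-count : {D : List ℚ} → Unique D → (L : List ℚ) → All (_∈ D) L → ∑[ v ← D ] (count v L * h v) ≡ ∑ h L
  ∑-count {D} _ [] [] = ∑-zeros {xs = D} (All.tabulate (λ _ → refl))
  ∑-count {D} unique (a ∷ L) (a∈ ∷ L⊆) = begin
      ∑[ v ← D ] (count v (a ∷ L) * h v)
    ≡⟨ ∑-cong (λ v → trans (cong (_* h v) (count-∷ v a L)) (*-distribʳ-+ (h v) (count v [ a ]) (count v L))) D ⟩
      ∑[ v ← D ] (count v [ a ] * h v + count v L * h v)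
    ≡⟨ ∑-+ (λ v → count v [ a ] * h v) (λ v → count v L * h v) D ⟩
      ∑[ v ← D ] (count v [ a ] * h v) + ∑[ v ← D ] (count v L * h v)
    ≡⟨ cong₂ _+_ (∑-count-[-] unique a∈) (∑-count unique L L⊆) ⟩
      h a + ∑ h L
    ∎
    where open ≡-Reasoning

-- The number of tuples of positions of L spelling t, so that N^b · P(I_b(F) = t) = multiplicity L t.
multiplicity : List ℚ → List ℚ → ℕ
multiplicity L t = product (map (λ v → count v L) t)

∑-tuples-multiplicity : {S : List ℚ} → Unique S → (L : List ℚ) → All (_∈ S) L → (b : ℕ) (h : List ℚ → ℕ) →
  ∑[ t ← tuples S b ] (multiplicity L t * h t) ≡ ∑ h (tuples L b)
∑-tuples-multiplicity _ L _ zero h = cong (_+ 0) (*-identityˡ (h []))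
∑-tuples-multiplicity {S} unique L L⊆S (suc b) h = begin
    ∑[ t ← tuples S (suc b) ] (multiplicity L t * h t)
  ≡⟨ ∑-tuples-suc (λ t → multiplicity L t * h t) S b ⟩
    ∑[ t ← tuples S b ] ∑[ v ← S ] (count v L * multiplicity L t * h (v ∷ t))
  ≡⟨ ∑-cong (λ t → trans (∑-cong (regroup t) S) (∑-*ˡ (multiplicity L t) _ S)) (tuples S b) ⟩
    ∑[ t ← tuples S b ] (multiplicity L t * ∑[ v ← S ] (count v L * h (v ∷ t)))
  ≡⟨ ∑-cong (λ t → cong (multiplicity L t *_) (∑-count (h ∘ (_∷ t)) unique L L⊆S)) (tuples S b) ⟩
    ∑[ t ← tuples S b ] (multiplicity L t * ∑[ a ← L ] h (a ∷ t))
  ≡⟨ ∑-tuples-multiplicity unique L L⊆S b (λ t → ∑[ a ← L ] h (a ∷ t)) ⟩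
    ∑[ t ← tuples L b ] ∑[ a ← L ] h (a ∷ t)
  ≡⟨ sym (∑-tuples-suc h L b) ⟩
    ∑ h (tuples L (suc b))
  ∎
  where
  open ≡-Reasoning
  regroup : ∀ t v → count v L * multiplicity L t * h (v ∷ t) ≡ multiplicity L t * (count v L * h (v ∷ t))
  regroup t v = trans (*-assoc (count v L) _ _) (x∙yz≈y∙xz (count v L) (multiplicity L t) (h (v ∷ t)))

toℚᵘ-/ : (a k : ℕ) → Q.toℚᵘ ((+ a) / suc k) ℚᵘ.≃ ℚᵘ.mkℚᵘ (+ a) k
toℚᵘ-/ a k = QP.toℚᵘ-fromℚᵘ (ℚᵘ.mkℚᵘ (+ a) k)

toℚ-+ : (m n : ℕ) → toℚ (m + n) ≡ toℚ m Q.+ toℚ n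
toℚ-+ m n = QP.toℚᵘ-injective (ℚᵘP.≃-trans (toℚᵘ-/ (m + n) 0) (ℚᵘP.≃-trans mkℚᵘ-+
  (ℚᵘP.≃-sym (ℚᵘP.≃-trans (QP.toℚᵘ-homo-+ (toℚ m) (toℚ n)) (ℚᵘP.+-cong (toℚᵘ-/ m 0) (toℚᵘ-/ n 0))))))
  where
  mkℚᵘ-+ : ℚᵘ.mkℚᵘ (+ (m + n)) 0 ℚᵘ.≃ ℚᵘ.mkℚᵘ (+ m) 0 ℚᵘ.+ ℚᵘ.mkℚᵘ (+ n) 0
  mkℚᵘ-+ = ℚᵘ.*≡* (trans (ℤP.*-identityʳ (+ (m + n))) (trans (ℤP.pos-+ m n)
    (sym (trans (ℤP.*-identityʳ _) (cong₂ ℤ._+_ (ℤP.*-identityʳ (+ m)) (ℤP.*-identityʳ (+ n)))))))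

toℚ-* : (m n : ℕ) → toℚ (m * n) ≡ toℚ m Q.* toℚ n
toℚ-* m n = QP.toℚᵘ-injective (ℚᵘP.≃-trans (toℚᵘ-/ (m * n) 0) (ℚᵘP.≃-trans mkℚᵘ-*
  (ℚᵘP.≃-sym (ℚᵘP.≃-trans (QP.toℚᵘ-homo-* (toℚ m) (toℚ n)) (ℚᵘP.*-cong (toℚᵘ-/ m 0) (toℚᵘ-/ n 0))))))
  where
  mkℚᵘ-* : ℚᵘ.mkℚᵘ (+ (m * n)) 0 ℚᵘ.≃ ℚᵘ.mkℚᵘ (+ m) 0 ℚᵘ.* ℚᵘ.mkℚᵘ (+ n) 0
  mkℚᵘ-* = ℚᵘ.*≡* (cong (ℤ._* + 1) (ℤP.pos-* m n))

/-*-toℚ : (a d : ℕ) .{{_ : NonZero d}} → ((+ a) / d) Q.* toℚ d ≡ toℚ a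
/-*-toℚ a (suc k) = QP.toℚᵘ-injective (ℚᵘP.≃-trans (QP.toℚᵘ-homo-* ((+ a) / suc k) (toℚ (suc k)))
  (ℚᵘP.≃-trans (ℚᵘP.*-cong (toℚᵘ-/ a k) (toℚᵘ-/ (suc k) 0))
  (ℚᵘP.≃-trans mkℚᵘ-cancel (ℚᵘP.≃-sym (toℚᵘ-/ a 0)))))
  where
  mkℚᵘ-cancel : ℚᵘ.mkℚᵘ (+ a) k ℚᵘ.* ℚᵘ.mkℚᵘ (+ suc k) 0 ℚᵘ.≃ ℚᵘ.mkℚᵘ (+ a) 0
  mkℚᵘ-cancel = ℚᵘ.*≡* (trans (cong (ℤ._* + 1) (sym (ℤP.pos-* a (suc k))))
    (trans (sym (ℤP.pos-* (a * suc k) 1)) (trans (cong +_ (reassoc a k)) (ℤP.pos-* a (suc (k * 1))))))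
    where
    reassoc : ∀ a k → a * suc k * 1 ≡ a * suc (k * 1)
    reassoc = solve-∀

instance
  toℚ-positive : {n : ℕ} .{{_ : NonZero n}} → Q.Positive (toℚ n)
  toℚ-positive {n} = QP.normalize-pos n 1

toℚ-mono-≤ : {m n : ℕ} → m ≤ n → toℚ m Q.≤ toℚ n
toℚ-mono-≤ {m} {n} m≤n = subst (λ k → toℚ m Q.≤ toℚ k) (m+[n∸m]≡n m≤n)
  (subst₂ Q._≤_ (QP.+-identityʳ (toℚ m)) (sym (toℚ-+ m (n ∸ m)))
    (QP.+-monoʳ-≤ (toℚ m) (QP.nonNegative⁻¹ (toℚ (n ∸ m)) {{QP.normalize-nonNeg (n ∸ m) 1}})))

*-cancelʳ-toℚ : (x y : ℚ) (c : ℕ) .{{_ : NonZero c}} → x Q.* toℚ c ≡ y Q.* toℚ c → x ≡ y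
*-cancelʳ-toℚ x y c xc≡yc = QP.≤-antisym (QP.*-cancelʳ-≤-pos (toℚ c) (QP.≤-reflexive xc≡yc))
                                          (QP.*-cancelʳ-≤-pos (toℚ c) (QP.≤-reflexive (sym xc≡yc)))

∑ℚ : {A : Set} → (A → ℚ) → List A → ℚ
∑ℚ f xs = sumℚ (map f xs)

module _ {A : Set} where

  toℚ-∑ : (f : A → ℕ) (xs : List A) → ∑ℚ (toℚ ∘ f) xs ≡ toℚ (∑ f xs)
  toℚ-∑ f [] = refl
  toℚ-∑ f (x ∷ xs) = trans (cong (toℚ (f x) Q.+_) (toℚ-∑ f xs)) (sym (toℚ-+ (f x) (∑ f xs)))

  ∑ℚ-*ʳ : (f : A → ℚ) (c : ℚ) (xs : List A) → ∑ℚ f xs Q.* c ≡ ∑ℚ (λ x → f x Q.* c) xs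
  ∑ℚ-*ʳ f c [] = QP.*-zeroˡ c
  ∑ℚ-*ʳ f c (x ∷ xs) = trans (QP.*-distribʳ-+ c (f x) (∑ℚ f xs)) (cong (f x Q.* c Q.+_) (∑ℚ-*ʳ f c xs))

  ∑ℚ-cong-All : {f g : A → ℚ} {xs : List A} → All (λ x → f x ≡ g x) xs → ∑ℚ f xs ≡ ∑ℚ g xs
  ∑ℚ-cong-All [] = refl
  ∑ℚ-cong-All (e ∷ es) = cong₂ Q._+_ e (∑ℚ-cong-All es)

*-toℚ-rescale : {x : ℚ} {a p : ℕ} → x Q.* toℚ a ≡ toℚ p → (c z : ℕ) → a * c ≡ z → x Q.* toℚ z ≡ toℚ (p * c)
*-toℚ-rescale {x} {a} {p} xa≡p c z refl = begin
    x Q.* toℚ (a * c)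
  ≡⟨ cong (x Q.*_) (toℚ-* a c) ⟩
    x Q.* (toℚ a Q.* toℚ c)
  ≡⟨ sym (QP.*-assoc x (toℚ a) (toℚ c)) ⟩
    (x Q.* toℚ a) Q.* toℚ c
  ≡⟨ cong (Q._* toℚ c) xa≡p ⟩
    toℚ p Q.* toℚ c
  ≡⟨ sym (toℚ-* p c) ⟩
    toℚ (p * c)
  ∎
  where open ≡-Reasoning

-≤-of-scaled : (x y r : ℚ) (p q s z : ℕ) .{{_ : NonZero z}} →
  x Q.* toℚ z ≡ toℚ p → y Q.* toℚ z ≡ toℚ q → r Q.* toℚ z ≡ toℚ s → p ≤ q + s → x - y Q.≤ r
-≤-of-scaled x y r p q s z xz≡p yz≡q rz≡s p≤q+s = QP.*-cancelʳ-≤-pos (toℚ z) (begin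
    (x - y) Q.* toℚ z
  ≡⟨ solve 3 (λ x y z → (x :- y) :* z := x :* z :- y :* z) refl x y (toℚ z) ⟩
    x Q.* toℚ z - y Q.* toℚ z
  ≡⟨ cong₂ _-_ xz≡p yz≡q ⟩
    toℚ p - toℚ q
  ≤⟨ QP.+-monoˡ-≤ (Q.- toℚ q) (subst (toℚ p Q.≤_) (toℚ-+ q s) (toℚ-mono-≤ p≤q+s)) ⟩
    (toℚ q Q.+ toℚ s) - toℚ q
  ≡⟨ solve 2 (λ q s → (q :+ s) :- q := s) refl (toℚ q) (toℚ s) ⟩
    toℚ s
  ≡⟨ sym rz≡s ⟩
    r Q.* toℚ z
  ∎)
  where
  open QP.≤-Reasoning
  open +-*-Solver

∣-∣≤-of-cross : {x y r : ℚ} (k m n p q s : ℕ) .{{_ : NonZero k}} .{{_ : NonZero m}} .{{_ : NonZero n}} →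
  x Q.* toℚ k ≡ toℚ p → y Q.* toℚ m ≡ toℚ q → r Q.* toℚ n ≡ toℚ s →
  p * (m * n) ≤ q * (k * n) + s * (k * m) → q * (k * n) ≤ p * (m * n) + s * (k * m) →
  ∣ x - y ∣ Q.≤ r
∣-∣≤-of-cross {x} {y} {r} k m n p q s xk≡p ym≡q rn≡s ≤₁ ≤₂ =
  [ (λ ∣x-y∣≡x-y → subst (Q._≤ r) (sym ∣x-y∣≡x-y)
                         (-≤-of-scaled x y r p′ q′ s′ z xz≡p′ yz≡q′ rz≡s′ ≤₁))
  , (λ ∣x-y∣≡y-x → subst (Q._≤ r) (sym (trans ∣x-y∣≡y-x (neg-sub x y)))
                         (-≤-of-scaled y x r q′ p′ s′ z yz≡q′ xz≡p′ rz≡s′ ≤₂))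
  ]′ (QP.∣p∣≡p∨∣p∣≡-p (x - y))
  where
  open +-*-Solver
  z = k * (m * n)
  p′ = p * (m * n)
  q′ = q * (k * n)
  s′ = s * (k * m)
  instance
    mn≢0 : NonZero (m * n)
    mn≢0 = m*n≢0 m n
    z≢0 : NonZero z
    z≢0 = m*n≢0 k (m * n)
  xz≡p′ : x Q.* toℚ z ≡ toℚ p′
  xz≡p′ = *-toℚ-rescale {x} {k} {p} xk≡p (m * n) z refl
  yz≡q′ : y Q.* toℚ z ≡ toℚ q′
  yz≡q′ = *-toℚ-rescale {y} {m} {q} ym≡q (k * n) z (x∙yz≈y∙xz m k n)
  rz≡s′ : r Q.* toℚ z ≡ toℚ s′
  rz≡s′ = *-toℚ-rescale {r} {n} {s} rn≡s (k * m) z (rotate n k m)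
    where
    rotate : ∀ n k m → n * (k * m) ≡ k * (m * n)
    rotate = solve-∀
  neg-sub : ∀ x y → Q.- (x - y) ≡ y - x
  neg-sub = solve 2 (λ x y → :- (x :- y) := y :- x) refl

module _ (L : List ℚ) .{{_ : NonZero (length L)}} where

  open +-*-Solver

  product-prob : (t : List ℚ) → productℚ (map (prob L) t) Q.* toℚ (length L ^ length t) ≡ toℚ (multiplicity L t)
  product-prob [] = refl
  product-prob (v ∷ t) = begin
      (prob L v Q.* Π) Q.* toℚ (N * N ^ length t)
    ≡⟨ cong ((prob L v Q.* Π) Q.*_) (toℚ-* N (N ^ length t)) ⟩
      (prob L v Q.* Π) Q.* (toℚ N Q.* toℚ (N ^ length t))
    ≡⟨ solve 4 (λ p Π n nᵏ → (p :* Π) :* (n :* nᵏ) := (p :* n) :* (Π :* nᵏ)) refl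
               (prob L v) Π (toℚ N) (toℚ (N ^ length t)) ⟩
      (prob L v Q.* toℚ N) Q.* (Π Q.* toℚ (N ^ length t))
    ≡⟨ cong₂ Q._*_ (/-*-toℚ (count v L) N) (product-prob t) ⟩
      toℚ (count v L) Q.* toℚ (multiplicity L t)
    ≡⟨ sym (toℚ-* (count v L) (multiplicity L t)) ⟩
      toℚ (multiplicity L (v ∷ t))
    ∎
    where
    open ≡-Reasoning
    N = length L
    Π = productℚ (map (prob L) t)

  E-iid-tuples : (A : List ℚ → ℕ) (b : ℕ) → E-iid A L b Q.* toℚ (length L ^ b) ≡ toℚ (∑ A (tuples L b))
  E-iid-tuples A b = begin
      ∑ℚ (λ t → Π t Q.* toℚ (A t)) T Q.* toℚ (N ^ b)
    ≡⟨ ∑ℚ-*ʳ (λ t → Π t Q.* toℚ (A t)) (toℚ (N ^ b)) T ⟩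
      ∑ℚ (λ t → (Π t Q.* toℚ (A t)) Q.* toℚ (N ^ b)) T
    ≡⟨ ∑ℚ-cong-All (All.map (λ {t} → weighted t) (tuples-have-length (support L) b)) ⟩
      ∑ℚ (λ t → toℚ (multiplicity L t * A t)) T
    ≡⟨ toℚ-∑ (λ t → multiplicity L t * A t) T ⟩
      toℚ (∑[ t ← T ] (multiplicity L t * A t))
    ≡⟨ cong toℚ (∑-tuples-multiplicity (deduplicate-! L) L (All.tabulate (∈-deduplicate⁺ Q._≟_)) b A) ⟩
      toℚ (∑ A (tuples L b))
    ∎
    where
    open ≡-Reasoning
    N = length L
    T = tuples (support L) b
    Π : List ℚ → ℚ
    Π t = productℚ (map (prob L) t)
    weighted : (t : List ℚ) → length t ≡ b → (Π t Q.* toℚ (A t)) Q.* toℚ (N ^ b) ≡ toℚ (multiplicity L t * A t)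
    weighted t refl = begin
        (Π t Q.* toℚ (A t)) Q.* toℚ (N ^ length t)
      ≡⟨ solve 3 (λ Π a nᵇ → (Π :* a) :* nᵇ := (Π :* nᵇ) :* a) refl
                 (Π t) (toℚ (A t)) (toℚ (N ^ length t)) ⟩
        (Π t Q.* toℚ (N ^ length t)) Q.* toℚ (A t)
      ≡⟨ cong (Q._* toℚ (A t)) (product-prob t) ⟩
        toℚ (multiplicity L t) Q.* toℚ (A t)
      ≡⟨ sym (toℚ-* (multiplicity L t) (A t)) ⟩
        toℚ (multiplicity L t * A t)
      ∎

  E-perm-permutations : (A : List ℚ → ℕ) (b : ℕ) →
    E-perm A L b Q.* toℚ (length L !) ≡ toℚ (∑[ σ ← permutations L ] A (take b σ))
  E-perm-permutations A b = begin
      (1/N! Q.* ∑ℚ (toℚ ∘ A ∘ take b) (permutations L)) Q.* toℚ (N !)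
    ≡⟨ cong (λ s → (1/N! Q.* s) Q.* toℚ (N !)) (toℚ-∑ (A ∘ take b) (permutations L)) ⟩
      (1/N! Q.* S) Q.* toℚ (N !)
    ≡⟨ solve 3 (λ x s f → (x :* s) :* f := (x :* f) :* s) refl 1/N! S (toℚ (N !)) ⟩
      (1/N! Q.* toℚ (N !)) Q.* S
    ≡⟨ cong (Q._* S) (/-*-toℚ 1 (N !) {{N !≢0}}) ⟩
      1ℚ Q.* S
    ≡⟨ QP.*-identityˡ S ⟩
      S
    ∎
    where
    open ≡-Reasoning
    N = length L
    1/N! = ((+ 1) / (N !)) {{N !≢0}}
    S = toℚ (∑[ σ ← permutations L ] A (take b σ))

  E-perm-arrangements : (A : List ℚ → ℕ) (b : ℕ) → b ≤ length L →
    E-perm A L b Q.* toℚ (length (arrangements L b)) ≡ toℚ (∑ A (arrangements L b))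
  E-perm-arrangements A b b≤N = *-cancelʳ-toℚ _ _ c {{(N ∸ b) !≢0}} (begin
      (E-perm A L b Q.* toℚ K) Q.* toℚ c
    ≡⟨ solve 3 (λ e k c → (e :* k) :* c := e :* (c :* k)) refl (E-perm A L b) (toℚ K) (toℚ c) ⟩
      E-perm A L b Q.* (toℚ c Q.* toℚ K)
    ≡⟨ cong (E-perm A L b Q.*_) (trans (sym (toℚ-* c K)) (cong toℚ (sym (length-!-arrangements L b b≤N)))) ⟩
      E-perm A L b Q.* toℚ (N !)
    ≡⟨ E-perm-permutations A b ⟩
      toℚ (∑[ σ ← permutations L ] A (take b σ))
    ≡⟨ cong toℚ (∑-permutations-take b L b≤N A) ⟩
      toℚ (c * ∑ A (arrangements L b))
    ≡⟨ trans (toℚ-* c _) (QP.*-comm (toℚ c) _) ⟩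
      toℚ (∑ A (arrangements L b)) Q.* toℚ c
    ∎)
    where
    open ≡-Reasoning
    N = length L
    K = length (arrangements L b)
    c = (N ∸ b) !

DNF-go≤length : (s : ℚ) (xs : List ℚ) → DNF-go s xs ≤ length xs
DNF-go≤length s [] = z≤n
DNF-go≤length s (a ∷ xs) with ⌊ 1ℚ Q.≤? (s Q.+ a) ⌋
... | true = s≤s (DNF-go≤length 0ℚ xs)
... | false = m≤n⇒m≤1+n (DNF-go≤length (s Q.+ a) xs)

DNF≤length : (xs : List ℚ) → DNF xs ≤ length xs
DNF≤length = DNF-go≤length 0ℚ

OPT≤length : (xs : List ℚ) → OPT xs ≤ length xs
OPT≤length xs = largest-feasible≤ (upTo (suc (length xs)))
  (AllP.applyUpTo⁺₁ (λ i → i) (suc (length xs)) (λ { (s≤s i≤|xs|) → i≤|xs| }))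
  where
  largest-feasible≤ : (ks : List ℕ) → All (_≤ length xs) ks →
    foldr (λ k m → if coverable xs k then k ⊔ m else m) 0 ks ≤ length xs
  largest-feasible≤ [] [] = z≤n
  largest-feasible≤ (k ∷ ks) (k≤ ∷ ks≤) with coverable xs k
  ... | true = ⊔-lub k≤ (largest-feasible≤ ks ks≤)
  ... | false = largest-feasible≤ ks ks≤

E-perm-E-iid-gap : (A : List ℚ → ℕ) → (∀ s → A s ≤ length s) →
  (L : List ℚ) .{{_ : NonZero (length L)}} → (b : ℕ) → b ≤ length L →
  ∣ E-perm A L b - E-iid A L b ∣ Q.≤ (+ (b ^ 3)) / length L
E-perm-E-iid-gap A A≤length L b b≤N =
  ∣-∣≤-of-cross {E-perm A L b} {E-iid A L b} K (N ^ b) N Q I (b ^ 3) {{K≢0}} {{m^n≢0 N b}}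
    (E-perm-arrangements L A b b≤N) (E-iid-tuples L A b) (/-*-toℚ (b ^ 3) N)
    (cross-bound-≤ Q≤I Q≤Kb I+Kb≤Q+Mb K≤M NM≤NK+b²M) (cross-bound-≥ Q≤I Q≤Kb I+Kb≤Q+Mb K≤M NM≤NK+b²M)
  where
  N = length L
  K = length (arrangements L b)
  Q = ∑ A (arrangements L b)
  I = ∑ A (tuples L b)
  bounded : Bounded b b A
  bounded s refl = A≤length s
  K≢0 : NonZero K
  K≢0 = m*n≢0⇒n≢0 ((N ∸ b) !) {{subst NonZero (length-!-arrangements L b b≤N) (N !≢0)}}
  Q≤I : Q ≤ I
  Q≤I = ∑-arrangements-≤-tuples b L A
  Q≤Kb : Q ≤ K * b
  Q≤Kb = ∑-≤-Bounded (arrangements-have-length L b) bounded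
  I+Kb≤Q+Mb : I + K * b ≤ Q + N ^ b * b
  I+Kb≤Q+Mb = ∑-tuples-≤-arrangements+ b b L A bounded
  K≤M : K ≤ N ^ b
  K≤M = subst (_≤ N ^ b) (sym (length-arrangements L b)) (P′≤^ N b)
  NM≤NK+b²M : N * N ^ b ≤ N * K + b * b * N ^ b
  NM≤NK+b²M = subst (λ k → N * N ^ b ≤ N * k + b * b * N ^ b) (sym (length-arrangements L b)) (^≤P′+ N b b≤N)

lemma5 : (L : List ℚ) → .{{_ : NonZero (length L)}} →
    All (λ a → (0ℚ Q.≤ a) × (a Q.≤ 1ℚ)) L →
    (b : ℕ) → b ≤ length L →
    (∣ E-perm DNF L b - E-iid DNF L b ∣ Q.≤ (+ (b ^ 3)) / length L)
    × (∣ E-perm OPT L b - E-iid OPT L b ∣ Q.≤ (+ (b ^ 3)) / length L)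
lemma5 L _ b b≤N = E-perm-E-iid-gap DNF DNF≤length L b b≤N , E-perm-E-iid-gap OPT OPT≤length L b b≤N
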